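{- Let $x,y\in\mathbb{Z}^3$ be orthogonal vectors with $\|x\|^2=\|y\|^2=nm^2$, where $n,m$ are positive integers and $n$ is squarefree. Then every coordinate of the cross product $x\times y$ is divisible by $nm$. -}

module Defs where

open import Data.Nat as ℕ using (ℕ)
open import Data.Nat.Divisibility as ℕD using ()
open import Data.Integer using (ℤ; _+_; _*_; _-_)
open import Data.Product using (_×_; _,_)
open import Relation.Binary.PropositionalEquality using (_≡_)

SquareFree : ℕ → Set
SquareFree n = ∀ (d : ℕ) → (d ℕ.* d) ℕD.∣ n → d ≡ 1

ℤ³ : Set
ℤ³ = ℤ × ℤ × ℤ

_·_ : ℤ³ → ℤ³ → ℤ
(a₁ , a₂ , a₃) · (b₁ , b₂ , b₃) = a₁ * b₁ + a₂ * b₂ + a₃ * b₃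

‖_‖² : ℤ³ → ℤ
‖ a ‖² = a · a

_×ᶜ_ : ℤ³ → ℤ³ → ℤ³
(a₁ , a₂ , a₃) ×ᶜ (b₁ , b₂ , b₃) =
  (a₂ * b₃ - a₃ * b₂) , (a₃ * b₁ - a₁ * b₃) , (a₁ * b₂ - a₂ * b₁)

open import Data.Product using (proj₁; proj₂)

coord₁ coord₂ coord₃ : ℤ³ → ℤ
coord₁ a = proj₁ a
coord₂ a = proj₁ (proj₂ a)
coord₃ a = proj₂ (proj₂ a)

-- Lagrange's identity together with x · y = 0 and ‖x‖² = ‖y‖² = N gives
-- (x × y)₁² = N (N − x₁² − y₁²), so N = n m² divides the square of each coordinate c
-- of the cross product. From m² ∣ c² we get c = w m and then n ∣ w², and since n is
-- squarefree, n ∣ w; hence n m ∣ c. Both divisibility steps compare a and b with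
-- their gcd g: writing a = a′ g, b = b′ g with a′, b′ coprime, the hypothesis forces
-- a′ ∣ b′ in the first case and a′² ∣ a in the second.
module Submission where

open import Defs
open import Data.Nat as ℕ using (ℕ; _>_; NonZero; >-nonZero; ≢-nonZero; ≢-nonZero⁻¹)
open import Data.Nat.Properties using (*-comm; m*n≢0)
open import Data.Nat.Divisibility as ℕ
  using (divides; ∣-trans; 1∣_; n∣m*n; m∣m*n; *-monoʳ-∣; *-monoˡ-∣; *-cancelʳ-∣)
open import Data.Nat.DivMod using (_/_; m/n*n≡m)
open import Data.Nat.GCD using (gcd; gcd[m,n]∣m; gcd[m,n]∣n; gcd[m,n]≢0)
open import Data.Nat.Coprimality using (Coprime; coprime-/gcd; coprime-divisor)
open import Data.Nat.Tactic.RingSolver as ℕ-Ring using ()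
open import Data.Integer as ℤ using (ℤ; +_; ∣_∣; _+_; _-_; _*_)
open import Data.Integer.Properties as ℤ using (abs-*)
open import Data.Integer.Divisibility using (_∣_)
open import Data.Integer.Tactic.RingSolver as ℤ-Ring using ()
open import Data.Product using (_×_; _,_)
open import Data.Sum using (inj₁)
open import Data.List.Base using (_∷_; [])
open import Relation.Binary.PropositionalEquality
  using (_≡_; refl; sym; trans; cong; cong₂; subst; subst₂; module ≡-Reasoning)

data GcdFactorisation : ℕ → ℕ → Set where
  factorise : ∀ a′ b′ g .{{_ : NonZero g}} → Coprime a′ b′ →
              GcdFactorisation (a′ ℕ.* g) (b′ ℕ.* g)

gcdFactorisation : ∀ a b .{{_ : NonZero a}} → GcdFactorisation a b
gcdFactorisation a b =
  subst₂ GcdFactorisation (m/n*n≡m (gcd[m,n]∣m a b)) (m/n*n≡m (gcd[m,n]∣n a b))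
    (factorise (a / gcd a b) (b / gcd a b) (gcd a b) (coprime-/gcd a b))
  where instance _ = ≢-nonZero (gcd[m,n]≢0 a b (inj₁ (≢-nonZero⁻¹ a)))

[m*n]*[m*n]≡[m*m]*[n*n] : ∀ m n → (m ℕ.* n) ℕ.* (m ℕ.* n) ≡ (m ℕ.* m) ℕ.* (n ℕ.* n)
[m*n]*[m*n]≡[m*m]*[n*n] = ℕ-Ring.solve-∀

[m*n]*[m*n]≡[m*[m*n]]*n : ∀ m n → (m ℕ.* n) ℕ.* (m ℕ.* n) ≡ (m ℕ.* (m ℕ.* n)) ℕ.* n
[m*n]*[m*n]≡[m*[m*n]]*n = ℕ-Ring.solve-∀

m*m∣n*n⇒m∣n : ∀ {m n} .{{_ : NonZero m}} → m ℕ.* m ℕ.∣ n ℕ.* n → m ℕ.∣ n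
m*m∣n*n⇒m∣n {m} {n} = go (gcdFactorisation m n)
  where
  go : ∀ {m n} → GcdFactorisation m n → m ℕ.* m ℕ.∣ n ℕ.* n → m ℕ.∣ n
  go (factorise a′ b′ g cop) h = *-monoˡ-∣ g (coprime-divisor cop a′∣b′*b′)
    where
    instance _ = m*n≢0 g g
    a′∣b′*b′ : a′ ℕ.∣ b′ ℕ.* b′
    a′∣b′*b′ = ∣-trans (m∣m*n a′) (*-cancelʳ-∣ (g ℕ.* g)
      (subst₂ ℕ._∣_ ([m*n]*[m*n]≡[m*m]*[n*n] a′ g) ([m*n]*[m*n]≡[m*m]*[n*n] b′ g) h))

squareFree∧∣n*n⇒∣n : ∀ {d n} .{{_ : NonZero d}} → SquareFree d → d ℕ.∣ n ℕ.* n → d ℕ.∣ n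
squareFree∧∣n*n⇒∣n {d} {n} = go (gcdFactorisation d n)
  where
  go : ∀ {d n} → GcdFactorisation d n → SquareFree d → d ℕ.∣ n ℕ.* n → d ℕ.∣ n
  go (factorise a′ b′ g cop) sf h =
    *-monoˡ-∣ g (subst (ℕ._∣ b′) (sym a′≡1) (1∣ b′))
    where
    a′∣g : a′ ℕ.∣ g
    a′∣g = coprime-divisor cop (coprime-divisor cop (*-cancelʳ-∣ g
      (subst (a′ ℕ.* g ℕ.∣_) ([m*n]*[m*n]≡[m*[m*n]]*n b′ g) h)))
    a′≡1 : a′ ≡ 1
    a′≡1 = sf a′ (*-monoʳ-∣ a′ a′∣g)

n*[m*m]∣z*z⇒n*m∣z : ∀ {n m z} .{{_ : NonZero n}} .{{_ : NonZero m}} → SquareFree n →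
                    n ℕ.* (m ℕ.* m) ℕ.∣ z ℕ.* z → n ℕ.* m ℕ.∣ z
n*[m*m]∣z*z⇒n*m∣z {n} {m} {z} sf h with m*m∣n*n⇒m∣n {m} {z} (∣-trans (n∣m*n n) h)
... | divides w refl = *-monoˡ-∣ m (squareFree∧∣n*n⇒∣n {n} {w} sf (*-cancelʳ-∣ (m ℕ.* m) {{m*n≢0 m m}}
  (subst (n ℕ.* (m ℕ.* m) ℕ.∣_) ([m*n]*[m*n]≡[m*m]*[n*n] w m) h)))

lagrange₂ : ∀ a₂ a₃ b₂ b₃ →
  (a₂ * b₃ - a₃ * b₂) * (a₂ * b₃ - a₃ * b₂) ≡
  (a₂ * a₂ + a₃ * a₃) * (b₂ * b₂ + b₃ * b₃) - (a₂ * b₂ + a₃ * b₃) * (a₂ * b₂ + a₃ * b₃)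
lagrange₂ = ℤ-Ring.solve-∀

·-without-coord₁ : ∀ a₁ a₂ a₃ b₁ b₂ b₃ →
  a₂ * b₂ + a₃ * b₃ ≡ (a₁ * b₁ + a₂ * b₂ + a₃ * b₃) - a₁ * b₁
·-without-coord₁ = ℤ-Ring.solve-∀

OrthogonalOfNorm : ℤ → ℤ³ → ℤ³ → Set
OrthogonalOfNorm N x y = x · y ≡ + 0 × ‖ x ‖² ≡ N × ‖ y ‖² ≡ N

coord₁-cross-square : ∀ {N} x y → OrthogonalOfNorm N x y →
  coord₁ (x ×ᶜ y) * coord₁ (x ×ᶜ y) ≡ N * (N - coord₁ x * coord₁ x - coord₁ y * coord₁ y)
coord₁-cross-square {N} x@(a₁ , a₂ , a₃) y@(b₁ , b₂ , b₃) (x⊥y , ‖x‖²≡N , ‖y‖²≡N) = begin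
  (a₂ * b₃ - a₃ * b₂) * (a₂ * b₃ - a₃ * b₂)
    ≡⟨ lagrange₂ a₂ a₃ b₂ b₃ ⟩
  (a₂ * a₂ + a₃ * a₃) * (b₂ * b₂ + b₃ * b₃) - (a₂ * b₂ + a₃ * b₃) * (a₂ * b₂ + a₃ * b₃)
    ≡⟨ cong₂ (λ u v → u - v * v)
         (cong₂ _*_ (·-without-coord₁ a₁ a₂ a₃ a₁ a₂ a₃) (·-without-coord₁ b₁ b₂ b₃ b₁ b₂ b₃))
         (·-without-coord₁ a₁ a₂ a₃ b₁ b₂ b₃) ⟩
  (‖ x ‖² - a₁ * a₁) * (‖ y ‖² - b₁ * b₁) - (x · y - a₁ * b₁) * (x · y - a₁ * b₁)
    ≡⟨ cong₂ (λ u v → u - v * v)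
         (cong₂ (λ s t → (s - a₁ * a₁) * (t - b₁ * b₁)) ‖x‖²≡N ‖y‖²≡N)
         (cong (_- a₁ * b₁) x⊥y) ⟩
  (N - a₁ * a₁) * (N - b₁ * b₁) - (+ 0 - a₁ * b₁) * (+ 0 - a₁ * b₁)
    ≡⟨ ℤ-Ring.solve (N ∷ a₁ ∷ b₁ ∷ []) ⟩
  N * (N - a₁ * a₁ - b₁ * b₁) ∎
  where open ≡-Reasoning

z*z≡[+d]*k⇒d∣∣z∣*∣z∣ : ∀ {d} z k → z * z ≡ + d * k → d ℕ.∣ ∣ z ∣ ℕ.* ∣ z ∣
z*z≡[+d]*k⇒d∣∣z∣*∣z∣ {d} z k eq = divides ∣ k ∣ (begin
  ∣ z ∣ ℕ.* ∣ z ∣  ≡⟨ abs-* z z ⟨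
  ∣ z * z ∣        ≡⟨ cong ∣_∣ eq ⟩
  ∣ + d * k ∣      ≡⟨ abs-* (+ d) k ⟩
  d ℕ.* ∣ k ∣      ≡⟨ *-comm d ∣ k ∣ ⟩
  ∣ k ∣ ℕ.* d      ∎)
  where open ≡-Reasoning

coord₁-cross-divisible : ∀ {n m} .{{_ : NonZero n}} .{{_ : NonZero m}} → SquareFree n →
  ∀ x y → OrthogonalOfNorm (+ (n ℕ.* (m ℕ.* m))) x y → + (n ℕ.* m) ∣ coord₁ (x ×ᶜ y)
coord₁-cross-divisible sf x y hyps =
  n*[m*m]∣z*z⇒n*m∣z sf (z*z≡[+d]*k⇒d∣∣z∣*∣z∣ (coord₁ (x ×ᶜ y)) _ (coord₁-cross-square x y hyps))

-- coord₂ (x ×ᶜ y) and coord₃ (x ×ᶜ y) are definitionally coord₁ of the cross product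
-- of the once and twice rotated vectors.
rotate : ℤ³ → ℤ³
rotate (a₁ , a₂ , a₃) = a₂ , a₃ , a₁

rotate-· : ∀ x y → rotate x · rotate y ≡ x · y
rotate-· (a₁ , a₂ , a₃) (b₁ , b₂ , b₃) =
  trans (ℤ.+-comm (a₂ * b₂ + a₃ * b₃) (a₁ * b₁)) (sym (ℤ.+-assoc (a₁ * b₁) (a₂ * b₂) (a₃ * b₃)))

rotate-orthogonalOfNorm : ∀ {N} x y → OrthogonalOfNorm N x y → OrthogonalOfNorm N (rotate x) (rotate y)
rotate-orthogonalOfNorm x y (x⊥y , ‖x‖²≡N , ‖y‖²≡N) =
  trans (rotate-· x y) x⊥y , trans (rotate-· x x) ‖x‖²≡N , trans (rotate-· y y) ‖y‖²≡N

proposition7p1 : ∀ (n m : ℕ) → n > 0 → m > 0 → SquareFree n →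
    ∀ (x y : ℤ³) →
    x · y ≡ + 0 →
    ‖ x ‖² ≡ + (n ℕ.* (m ℕ.* m)) →
    ‖ y ‖² ≡ + (n ℕ.* (m ℕ.* m)) →
    (+ (n ℕ.* m) ∣ coord₁ (x ×ᶜ y)) × (+ (n ℕ.* m) ∣ coord₂ (x ×ᶜ y)) × (+ (n ℕ.* m) ∣ coord₃ (x ×ᶜ y))
proposition7p1 n m n>0 m>0 sf x y x⊥y ‖x‖²≡N ‖y‖²≡N =
  divisible x y hyps ,
  divisible (rotate x) (rotate y) hyps′ ,
  divisible (rotate (rotate x)) (rotate (rotate y)) (rotate-orthogonalOfNorm (rotate x) (rotate y) hyps′)
  where
  instance _ = >-nonZero n>0
  instance _ = >-nonZero m>0
  N : ℤ
  N = + (n ℕ.* (m ℕ.* m))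
  divisible : ∀ u v → OrthogonalOfNorm N u v → + (n ℕ.* m) ∣ coord₁ (u ×ᶜ v)
  divisible = coord₁-cross-divisible sf
  hyps : OrthogonalOfNorm N x y
  hyps = x⊥y , ‖x‖²≡N , ‖y‖²≡N
  hyps′ : OrthogonalOfNorm N (rotate x) (rotate y)
  hyps′ = rotate-orthogonalOfNorm x y hyps
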